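{- Let $D, k$ be positive integers with $D > 10k^2$. For $0 \le d \le D$ let $L_d := \{x \in \mathbb{F}_2^D : |x| = d\}$, where $|x|$ is the number of nonzero coordinates of $x$. Let $\Sigma = L_{\ell} \cup L_{\ell+1} \cup \dots \cup L_{\ell + k - 1}$ for some integer $\ell$ (a band of width $k$), and suppose $A \subset \Sigma$. Let $S = \{e_1,\dots, e_D\}$ be the set of standard basis vectors of $\mathbb{F}_2^D$ and let $kS = \{s_1 + \dots + s_k : s_1,\dots,s_k \in S\}$ be the $k$-fold sumset. Then \[ |(A + kS) \setminus \Sigma| \geq \tfrac{1}{2}|A|.\]
   Context: $A + kS = \{a + s : a \in A, s \in kS\}$. -}

module Defs where

open import Data.Bool using (Bool; true; false; _xor_; not; _∧_; T)
open import Data.Bool.Properties using () renaming (_≟_ to _≟B_)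
open import Data.Nat using (ℕ; zero; suc)
open import Data.Integer using (ℤ; +_; _≤ᵇ_) renaming (_+_ to _+ℤ_)
open import Data.Fin using (Fin)
open import Data.Fin.Properties using () renaming (_≟_ to _≟F_)
open import Data.Vec using (Vec; []; _∷_; zipWith; tabulate; replicate; foldr; count)
open import Data.Vec.Properties using (≡-dec)
open import Data.List using (List; []; _∷_; map; concatMap; length; filterᵇ; deduplicate; allFin)
open import Relation.Nullary.Decidable using (does)

-- Points of F₂^D are Boolean vectors of length D (true = 1, false = 0).
F₂^ : ℕ → Set
F₂^ D = Vec Bool D

_⊕_ : ∀ {D} → F₂^ D → F₂^ D → F₂^ D
_⊕_ = zipWith _xor_

𝟎 : ∀ {D} → F₂^ D
𝟎 = replicate _ false

e : ∀ {D} → Fin D → F₂^ D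
e i = tabulate (λ j → does (i ≟F j))

wt : ∀ {D} → F₂^ D → ℕ
wt = count (λ b → b ≟B true)

tuples : (D k : ℕ) → List (Vec (Fin D) k)
tuples D zero = [] ∷ []
tuples D (suc k) = concatMap (λ i → map (i ∷_) (tuples D k)) (allFin D)

sumBasis : ∀ {D k} → Vec (Fin D) k → F₂^ D
sumBasis = foldr _ (λ i acc → e i ⊕ acc) 𝟎

-- kS = { s₁ + … + s_k : sᵢ ∈ S }, S = {e₁,…,e_D}, as a list (possibly with repetitions).
kS : (D k : ℕ) → List (F₂^ D)
kS D k = map sumBasis (tuples D k)

sumset : ∀ {D} → List (F₂^ D) → List (F₂^ D) → List (F₂^ D)
sumset A B = concatMap (λ a → map (a ⊕_) B) A

inBand : ∀ {D} → ℤ → ℕ → F₂^ D → Bool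
inBand ℓ k x = (ℓ ≤ᵇ + wt x) ∧ (+ suc (wt x) ≤ᵇ ℓ +ℤ + k)

_≟V_ : ∀ {D} (x y : F₂^ D) → _
_≟V_ = ≡-dec _≟B_

card : ∀ {D} → List (F₂^ D) → ℕ
card xs = length (deduplicate _≟V_ xs)

outside : (D k : ℕ) (ℓ : ℤ) → List (F₂^ D) → ℕ
outside D k ℓ A = card (filterᵇ (λ x → not (inBand ℓ k x)) (sumset A (kS D k)))

-- Split A into weight layers A_w.  A layer below the middle level is
-- pushed k levels up (toggling 0-coordinates), a layer above it k levels down
-- (toggling 1-coordinates); both are the "c-shadow" that toggles a coordinate
-- equal to c, so every layer starts at a level m ≤ D/2 counted from c.
--  * Double counting pairs (point, toggled coordinate) gives the local LYM
--    inequality |B|(D - m) ≤ |∂B|(m + 1) for a level-m set B; iterated k times,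
--    |B| ∏ (D - m - j) ≤ |∂ᵏB| ∏ (m + j + 1)   (shadow-LYM, shadow^-LYM).
--  * For m ≤ D/2 and D > 10k² the second product is at most twice the first
--    (up-down-ratio), so |∂ᵏA_w| ≥ |A_w|/2   (shadow^-halves).
--  * ∂ᵏA_w ⊆ A + kS lies at weight w ± k, hence outside Σ, and since weights in
--    Σ differ by less than k the sets ∂ᵏA_w are disjoint for distinct w.

module Submission where

open import Defs
open import Data.Bool using (Bool; true; false; not; T)
open import Data.Bool.Properties using (xor-comm; xor-assoc; xor-identityʳ; T-∧) renaming (_≟_ to _≟B_)
open import Data.Nat
open import Data.Nat.Properties
open import Data.Nat.Tactic.RingSolver using (solve-∀)
open import Data.Integer as ℤ using (ℤ; +_)
import Data.Integer.Properties as ℤ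
open import Data.Fin as Fin using (Fin; zero; suc)
import Data.Fin.Properties as Finₚ
open import Data.Vec using (Vec; []; _∷_; lookup; count; tabulate)
open import Data.Vec.Properties using (zipWith-identityʳ; zipWith-assoc; zipWith-comm; tabulate-∘; map-const; count≤n)
open import Data.List using (List; []; _∷_; map; length; _++_; concatMap; deduplicate; filter; filterᵇ)
open import Data.List.Properties using (length-map; length-++; filter-accept; filter-reject; filter-all; filter-none)
open import Data.List.Membership.Propositional using (_∈_; find; lose)
open import Data.List.Membership.Propositional.Properties
open import Data.List.Relation.Unary.Any using (here; there)
open import Data.List.Relation.Unary.All as All using (All; []; _∷_)
import Data.List.Relation.Unary.All.Properties as All
open import Data.List.Relation.Unary.Unique.Propositional using (Unique; []; _∷_)
import Data.List.Relation.Unary.Unique.Propositional.Properties as Unique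
open import Data.List.Relation.Unary.Unique.DecPropositional.Properties using (deduplicate-!)
open import Data.Product using (∃; _×_; _,_; proj₁; proj₂; map₁)
open import Data.Sum using (_⊎_; inj₁; inj₂)
open import Data.Empty using (⊥; ⊥-elim)
open import Function using (id)
open import Function.Bundles using (Equivalence)
open import Relation.Nullary using (¬_; yes; no)
open import Relation.Binary.Definitions using (tri<; tri≈; tri>)
open import Relation.Nullary.Decidable using (T?)
open import Relation.Binary.PropositionalEquality

toggle : ∀ {D} → Fin D → F₂^ D → F₂^ D
toggle zero (b ∷ x) = not b ∷ x
toggle (suc i) (b ∷ x) = b ∷ toggle i x

⊕-𝟎 : ∀ {D} (x : F₂^ D) → x ⊕ 𝟎 ≡ x
⊕-𝟎 = zipWith-identityʳ xor-identityʳ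

⊕-e : ∀ {D} (i : Fin D) (x : F₂^ D) → x ⊕ e i ≡ toggle i x
⊕-e zero (b ∷ x) = cong₂ _∷_ (xor-comm b true) (trans (cong (x ⊕_) allFalse) (⊕-𝟎 x))
  where
  allFalse : tabulate (λ _ → false) ≡ 𝟎
  allFalse = trans (tabulate-∘ (λ _ → false) id) (map-const _ false)
⊕-e (suc i) (b ∷ x) = cong₂ _∷_ (xor-identityʳ b) (⊕-e i x)

toggle-involutive : ∀ {D} (i : Fin D) (x : F₂^ D) → toggle i (toggle i x) ≡ x
toggle-involutive zero (false ∷ x) = refl
toggle-involutive zero (true ∷ x) = refl
toggle-involutive (suc i) (b ∷ x) = cong (b ∷_) (toggle-involutive i x)

toggle-injective : ∀ {D} (i : Fin D) {x y : F₂^ D} → toggle i x ≡ toggle i y → x ≡ y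
toggle-injective i {x} {y} eq = begin
  x                     ≡⟨ toggle-involutive i x ⟨
  toggle i (toggle i x) ≡⟨ cong (toggle i) eq ⟩
  toggle i (toggle i y) ≡⟨ toggle-involutive i y ⟩
  y ∎
  where open ≡-Reasoning

lookup-toggle : ∀ {D} (i : Fin D) (x : F₂^ D) → lookup (toggle i x) i ≡ not (lookup x i)
lookup-toggle zero (b ∷ x) = refl
lookup-toggle (suc i) (b ∷ x) = lookup-toggle i x

cnt : ∀ {D} → Bool → F₂^ D → ℕ
cnt c = count (_≟B c)

cnt-complement : ∀ {D} c (x : F₂^ D) → cnt c x + cnt (not c) x ≡ D
cnt-complement c [] = refl
cnt-complement true (true ∷ x) = cong suc (cnt-complement true x)
cnt-complement true (false ∷ x) = trans (+-suc (cnt true x) _) (cong suc (cnt-complement true x))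
cnt-complement false (true ∷ x) = trans (+-suc (cnt false x) _) (cong suc (cnt-complement false x))
cnt-complement false (false ∷ x) = cong suc (cnt-complement false x)

cnt-by-complement : ∀ {D} c (x : F₂^ D) → cnt c x ≡ D ∸ cnt (not c) x
cnt-by-complement c x =
  trans (sym (m+n∸n≡m (cnt c x) (cnt (not c) x))) (cong (_∸ cnt (not c) x) (cnt-complement c x))

toggle-raises : ∀ {D} c (i : Fin D) (x : F₂^ D) → lookup x i ≡ c →
  cnt (not c) (toggle i x) ≡ suc (cnt (not c) x)
toggle-raises true zero (true ∷ x) refl = refl
toggle-raises false zero (false ∷ x) refl = refl
toggle-raises c (suc i) (b ∷ x) xᵢ≡c with b ≟B not c
... | yes _ = cong suc (toggle-raises c i x xᵢ≡c)
... | no _ = toggle-raises c i x xᵢ≡c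

positions : ∀ {D} → Bool → F₂^ D → List (Fin D)
positions c [] = []
positions c (b ∷ x) with b ≟B c
... | yes _ = zero ∷ map suc (positions c x)
... | no _ = map suc (positions c x)

length-positions : ∀ {D} c (x : F₂^ D) → length (positions c x) ≡ cnt c x
length-positions c [] = refl
length-positions c (b ∷ x) with b ≟B c
... | yes _ = cong suc (trans (length-map suc (positions c x)) (length-positions c x))
... | no _ = trans (length-map suc (positions c x)) (length-positions c x)

positions-unique : ∀ {D} c (x : F₂^ D) → Unique (positions c x)
positions-unique c [] = []
positions-unique c (b ∷ x) with b ≟B c
... | yes _ = All.map⁺ (All.tabulate (λ _ ())) ∷ Unique.map⁺ Finₚ.suc-injective (positions-unique c x)
... | no _ = Unique.map⁺ Finₚ.suc-injective (positions-unique c x)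

∈-map-suc⁻ : ∀ {n} {j : Fin n} {l : List (Fin n)} → Fin.suc j ∈ map suc l → j ∈ l
∈-map-suc⁻ j∈ with ∈-map⁻ suc j∈
... | _ , j∈l , refl = j∈l

zero∉map-suc : ∀ {n} {l : List (Fin n)} → ¬ (Fin.zero ∈ map suc l)
zero∉map-suc 0∈ with ∈-map⁻ suc 0∈
... | _ , _ , ()

∈-positions⁻ : ∀ {D} c (x : F₂^ D) {i} → i ∈ positions c x → lookup x i ≡ c
∈-positions⁻ c (b ∷ x) {i} i∈ with b ≟B c
∈-positions⁻ c (b ∷ x) {zero} _ | yes b≡c = b≡c
∈-positions⁻ c (b ∷ x) {suc i} (there i∈) | yes _ = ∈-positions⁻ c x (∈-map-suc⁻ i∈)
∈-positions⁻ c (b ∷ x) {zero} i∈ | no _ = ⊥-elim (zero∉map-suc i∈)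
∈-positions⁻ c (b ∷ x) {suc i} i∈ | no _ = ∈-positions⁻ c x (∈-map-suc⁻ i∈)

∈-positions⁺ : ∀ {D} c (x : F₂^ D) {i} → lookup x i ≡ c → i ∈ positions c x
∈-positions⁺ c (b ∷ x) {i} xᵢ≡c with b ≟B c
∈-positions⁺ c (b ∷ x) {zero} _ | yes _ = here refl
∈-positions⁺ c (b ∷ x) {suc i} xᵢ≡c | yes _ = there (∈-map⁺ suc (∈-positions⁺ c x xᵢ≡c))
∈-positions⁺ c (b ∷ x) {zero} b≡c | no b≢c = ⊥-elim (b≢c b≡c)
∈-positions⁺ c (b ∷ x) {suc i} xᵢ≡c | no _ = ∈-map⁺ suc (∈-positions⁺ c x xᵢ≡c)

module _ {a} {A : Set a} where

  unique-⊆-length : ∀ {xs ys : List A} → Unique xs → (∀ {z} → z ∈ xs → z ∈ ys) →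
    length xs ≤ length ys
  unique-⊆-length {[]} _ _ = z≤n
  unique-⊆-length {x ∷ xs} (x∉xs ∷ uxs) xs⊆ys with ∈-∃++ (xs⊆ys (here refl))
  ... | us , vs , refl = begin
      suc (length xs)       ≤⟨ s≤s (unique-⊆-length uxs xs⊆us++vs) ⟩
      suc (length (us ++ vs)) ≡⟨ cong suc (length-++ us) ⟩
      suc (length us + length vs) ≡⟨ +-suc (length us) (length vs) ⟨
      length us + length (x ∷ vs) ≡⟨ length-++ us ⟨
      length (us ++ x ∷ vs) ∎
    where
    open ≤-Reasoning
    -- removing the one copy of x from ys still covers xs, since x ∉ xs
    xs⊆us++vs : ∀ {z} → z ∈ xs → z ∈ us ++ vs
    xs⊆us++vs z∈xs with ∈-++⁻ us (xs⊆ys (there z∈xs))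
    ... | inj₁ z∈us = ∈-++⁺ˡ z∈us
    ... | inj₂ (here refl) = ⊥-elim (All.lookup x∉xs z∈xs refl)
    ... | inj₂ (there z∈vs) = ∈-++⁺ʳ us z∈vs

module _ {a b} {A : Set a} {B : Set b} where

  pairs : (A → List B) → List A → List (A × B)
  pairs f = concatMap (λ x → map (x ,_) (f x))

  length-pairs : ∀ (f : A → List B) r xs → All (λ x → length (f x) ≡ r) xs →
    length (pairs f xs) ≡ length xs * r
  length-pairs f r [] [] = refl
  length-pairs f r (x ∷ xs) (fx≡r ∷ rest) = trans (length-++ (map (x ,_) (f x)))
    (cong₂ _+_ (trans (length-map _ (f x)) fx≡r) (length-pairs f r xs rest))

  ∈-pairs⁻ : ∀ (f : A → List B) xs {x i} → (x , i) ∈ pairs f xs → x ∈ xs × i ∈ f x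
  ∈-pairs⁻ f (y ∷ xs) p with ∈-++⁻ (map (y ,_) (f y)) p
  ... | inj₂ q = map₁ there (∈-pairs⁻ f xs q)
  ... | inj₁ q with ∈-map⁻ (y ,_) q
  ...   | _ , i∈ , refl = here refl , i∈

  ∈-pairs⁺ : ∀ (f : A → List B) xs {x i} → x ∈ xs → i ∈ f x → (x , i) ∈ pairs f xs
  ∈-pairs⁺ f (y ∷ xs) (here refl) i∈ = ∈-++⁺ˡ (∈-map⁺ (y ,_) i∈)
  ∈-pairs⁺ f (y ∷ xs) (there x∈) i∈ = ∈-++⁺ʳ (map (y ,_) (f y)) (∈-pairs⁺ f xs x∈ i∈)

  pairs-unique : ∀ (f : A → List B) xs → Unique xs → (∀ x → Unique (f x)) → Unique (pairs f xs)
  pairs-unique f [] _ _ = []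
  pairs-unique f (x ∷ xs) (x∉xs ∷ uxs) uf =
    Unique.++⁺ (Unique.map⁺ ,-injective (uf x)) (pairs-unique f xs uxs uf) disjoint
    where
    ,-injective : ∀ {i j} → (x , i) ≡ (x , j) → i ≡ j
    ,-injective refl = refl
    disjoint : ∀ {v} → v ∈ map (x ,_) (f x) × v ∈ pairs f xs → ⊥
    disjoint (p , q) with ∈-map⁻ (x ,_) p
    ... | _ , _ , refl = All.lookup x∉xs (proj₁ (∈-pairs⁻ f xs q)) refl

AtLevel : ∀ {D} → Bool → ℕ → List (F₂^ D) → Set
AtLevel c m B = All (λ x → cnt (not c) x ≡ m) B

neighbours : ∀ {D} → Bool → F₂^ D → List (F₂^ D)
neighbours c x = map (λ i → toggle i x) (positions c x)

shadow : ∀ {D} → Bool → List (F₂^ D) → List (F₂^ D)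
shadow c B = deduplicate _≟V_ (concatMap (neighbours c) B)

shadow-unique : ∀ {D} c (B : List (F₂^ D)) → Unique (shadow c B)
shadow-unique c B = deduplicate-! _≟V_ (concatMap (neighbours c) B)

ToggledFrom : ∀ {D} → Bool → List (F₂^ D) → F₂^ D → Set
ToggledFrom c B y = ∃ λ x → x ∈ B × ∃ λ i → i ∈ positions c x × y ≡ toggle i x

∈-shadow⁻ : ∀ {D} c (B : List (F₂^ D)) {y} → y ∈ shadow c B → ToggledFrom c B y
∈-shadow⁻ c B y∈ with find (∈-concatMap⁻ (neighbours c) {xs = B}
                              (∈-deduplicate⁻ _≟V_ (concatMap (neighbours c) B) y∈))
... | x , x∈ , y∈nx with ∈-map⁻ (λ i → toggle i x) y∈nx
... | i , i∈ , y≡ = x , x∈ , i , i∈ , y≡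

∈-shadow⁺ : ∀ {D} c (B : List (F₂^ D)) {x i} → x ∈ B → i ∈ positions c x →
  toggle i x ∈ shadow c B
∈-shadow⁺ c B x∈ i∈ =
  ∈-deduplicate⁺ _≟V_ (∈-concatMap⁺ (neighbours c) (lose x∈ (∈-map⁺ (λ i → toggle i _) i∈)))

shadow-level : ∀ {D} c m (B : List (F₂^ D)) → AtLevel c m B → AtLevel c (suc m) (shadow c B)
shadow-level c m B lvl = All.tabulate λ y∈ → raised (∈-shadow⁻ c B y∈)
  where
  raised : ∀ {y} → ToggledFrom c B y → cnt (not c) y ≡ suc m
  raised (x , x∈ , i , i∈ , refl) =
    trans (toggle-raises c i x (∈-positions⁻ c x i∈)) (cong suc (All.lookup lvl x∈))

-- The pairs (x , i) with x ∈ B and xᵢ = c number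
-- |B|(D - m); toggling i maps them injectively to the pairs (y , i) with
-- y ∈ shadow c B and yᵢ ≠ c, which number |shadow c B|(m + 1).
shadow-LYM : ∀ {D} c m (B : List (F₂^ D)) → Unique B → AtLevel c m B →
  length B * (D ∸ m) ≤ length (shadow c B) * suc m
shadow-LYM {D} c m B uB lvl = begin
    length B * (D ∸ m)          ≡⟨ length-pairs (positions c) (D ∸ m) B lenP ⟨
    length P                    ≡⟨ length-map move P ⟨
    length (map move P)         ≤⟨ unique-⊆-length (Unique.map⁺ move-injective uP) move-into ⟩
    length Q                    ≡⟨ length-pairs (positions (not c)) (suc m) ∂B lenQ ⟩
    length ∂B * suc m ∎
  where
  open ≤-Reasoning
  ∂B = shadow c B
  P = pairs (positions c) B
  Q = pairs (positions (not c)) ∂B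
  uP : Unique P
  uP = pairs-unique (positions c) B uB (positions-unique c)
  lenP : All (λ x → length (positions c x) ≡ D ∸ m) B
  lenP = All.tabulate λ {x} x∈ →
    trans (length-positions c x) (trans (cnt-by-complement c x) (cong (D ∸_) (All.lookup lvl x∈)))
  lenQ : All (λ y → length (positions (not c) y) ≡ suc m) ∂B
  lenQ = All.tabulate λ {y} y∈ →
    trans (length-positions (not c) y) (All.lookup (shadow-level c m B lvl) y∈)
  move : F₂^ D × Fin D → F₂^ D × Fin D
  move (x , i) = toggle i x , i
  move-injective : ∀ {p q} → move p ≡ move q → p ≡ q
  move-injective {x , i} {x′ , i′} eq with cong proj₂ eq
  ... | refl = cong (_, i) (toggle-injective i (cong proj₁ eq))
  move-into : ∀ {z} → z ∈ map move P → z ∈ Q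
  move-into z∈ with ∈-map⁻ move z∈
  ... | (x , i) , p∈ , refl with ∈-pairs⁻ (positions c) B p∈
  ... | x∈ , i∈ = ∈-pairs⁺ (positions (not c)) ∂B (∈-shadow⁺ c B x∈ i∈)
        (∈-positions⁺ (not c) (toggle i x) (trans (lookup-toggle i x) (cong not (∈-positions⁻ c x i∈))))

shadow^ : ∀ {D} → Bool → ℕ → List (F₂^ D) → List (F₂^ D)
shadow^ c zero B = B
shadow^ c (suc j) B = shadow c (shadow^ c j B)

shadow^-unique : ∀ {D} c j (B : List (F₂^ D)) → Unique B → Unique (shadow^ c j B)
shadow^-unique c zero B uB = uB
shadow^-unique c (suc j) B uB = shadow-unique c (shadow^ c j B)

shadow^-level : ∀ {D} c m j (B : List (F₂^ D)) → AtLevel c m B → AtLevel c (m + j) (shadow^ c j B)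
shadow^-level c m zero B lvl = All.map (λ eq → trans eq (sym (+-identityʳ m))) lvl
shadow^-level c m (suc j) B lvl =
  All.map (λ eq → trans eq (sym (+-suc m j))) (shadow-level c (m + j) _ (shadow^-level c m j B lvl))

toggle-sumBasis : ∀ {D j} (i : Fin D) (a : F₂^ D) (s : Vec (Fin D) j) →
  toggle i (a ⊕ sumBasis s) ≡ a ⊕ sumBasis (i ∷ s)
toggle-sumBasis i a s = begin
  toggle i (a ⊕ sumBasis s)  ≡⟨ ⊕-e i _ ⟨
  (a ⊕ sumBasis s) ⊕ e i     ≡⟨ zipWith-assoc xor-assoc a (sumBasis s) (e i) ⟩
  a ⊕ (sumBasis s ⊕ e i)     ≡⟨ cong (a ⊕_) (zipWith-comm xor-comm (sumBasis s) (e i)) ⟩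
  a ⊕ (e i ⊕ sumBasis s) ∎
  where open ≡-Reasoning

shadow^-origin : ∀ {D} c j (B : List (F₂^ D)) {y} → y ∈ shadow^ c j B →
  ∃ λ a → a ∈ B × ∃ λ (s : Vec (Fin D) j) → y ≡ a ⊕ sumBasis s
shadow^-origin c zero B {y} y∈ = y , y∈ , [] , sym (⊕-𝟎 y)
shadow^-origin c (suc j) B y∈ with ∈-shadow⁻ c (shadow^ c j B) y∈
... | x , x∈ , i , _ , refl with shadow^-origin c j B x∈
... | a , a∈ , s , refl = a , a∈ , i ∷ s , toggle-sumBasis i a s

prod : ℕ → (ℕ → ℕ) → ℕ
prod zero f = 1
prod (suc n) f = prod n f * f n

-- The factors in the iterated LYM inequality started at level m: at step j a
-- point has D - m - j coordinates it may toggle, and a point of the next level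
-- arises from at most m + j + 1 points of the previous one.
up : ℕ → ℕ → ℕ
up m j = suc (m + j)

down : ℕ → ℕ → ℕ → ℕ
down D m j = D ∸ (m + j)

shadow^-LYM : ∀ {D} c m j (B : List (F₂^ D)) → Unique B → AtLevel c m B →
  length B * prod j (down D m) ≤ length (shadow^ c j B) * prod j (up m)
shadow^-LYM c m zero B uB lvl = ≤-refl
shadow^-LYM {D} c m (suc j) B uB lvl = begin
  length B * (Y * y)          ≡⟨ *-assoc (length B) Y y ⟨
  length B * Y * y            ≤⟨ *-monoˡ-≤ y (shadow^-LYM c m j B uB lvl) ⟩
  length Bⱼ * X * y           ≡⟨ swap-last (length Bⱼ) X y ⟩
  length Bⱼ * y * X           ≤⟨ *-monoˡ-≤ X (shadow-LYM c (m + j) Bⱼ uBⱼ (shadow^-level c m j B lvl)) ⟩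
  length (shadow c Bⱼ) * x * X ≡⟨ swap-last (length (shadow c Bⱼ)) x X ⟩
  length (shadow c Bⱼ) * X * x ≡⟨ *-assoc (length (shadow c Bⱼ)) X x ⟩
  length (shadow c Bⱼ) * (X * x) ∎
  where
  open ≤-Reasoning
  Bⱼ = shadow^ c j B
  uBⱼ = shadow^-unique c j B uB
  X = prod j (up m)
  Y = prod j (down D m)
  x = up m j
  y = down D m j
  swap-last : ∀ a b c → a * b * c ≡ a * c * b
  swap-last = solve-∀

prod-mono : ∀ n {f g : ℕ → ℕ} → (∀ j → j < n → f j ≤ g j) → prod n f ≤ prod n g
prod-mono zero f≤g = ≤-refl
prod-mono (suc n) f≤g = *-mono-≤ (prod-mono n (λ j j<n → f≤g j (m<n⇒m<1+n j<n))) (f≤g n ≤-refl)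

prod-perturb : ∀ M c n {f g : ℕ → ℕ} →
  (∀ j → j < n → g j ≤ f j × f j ≤ g j + c × M ≤ f j) →
  M * prod n f ≤ M * prod n g + c * n * prod n f
prod-perturb M c zero _ = m≤m+n (M * 1) (c * 0 * 1)
prod-perturb M c (suc n) {f} {g} close = begin
  M * (F * x)                           ≡⟨ *-assoc M F x ⟨
  M * F * x                             ≤⟨ *-monoʳ-≤ (M * F) x≤y+c ⟩
  M * F * (y + c)                       ≡⟨ *-distribˡ-+ (M * F) y c ⟩
  M * F * y + M * F * c                 ≤⟨ +-mono-≤ (*-monoˡ-≤ y (prod-perturb M c n close′))
                                                    (*-monoˡ-≤ c (*-monoˡ-≤ F M≤x)) ⟩
  (M * G + c * n * F) * y + x * F * c   ≡⟨ regroup₁ M G c n F y x ⟩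
  M * (G * y) + c * n * (F * y) + c * (F * x) ≤⟨ +-monoˡ-≤ (c * (F * x))
                                                    (+-monoʳ-≤ (M * (G * y)) (*-monoʳ-≤ (c * n) (*-monoʳ-≤ F y≤x))) ⟩
  M * (G * y) + c * n * (F * x) + c * (F * x) ≡⟨ regroup₂ M G c n F y x ⟩
  M * (G * y) + c * suc n * (F * x) ∎
  where
  open ≤-Reasoning
  F = prod n f
  G = prod n g
  x = f n
  y = g n
  y≤x = proj₁ (close n ≤-refl)
  x≤y+c = proj₁ (proj₂ (close n ≤-refl))
  M≤x = proj₂ (proj₂ (close n ≤-refl))
  close′ : ∀ j → j < n → g j ≤ f j × f j ≤ g j + c × M ≤ f j
  close′ j j<n = close j (m<n⇒m<1+n j<n)
  regroup₁ : ∀ M G c n F y x →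
    (M * G + c * n * F) * y + x * F * c ≡ M * (G * y) + c * n * (F * y) + c * (F * x)
  regroup₁ = solve-∀
  regroup₂ : ∀ M G c n F y x →
    M * (G * y) + c * n * (F * x) + c * (F * x) ≡ M * (G * y) + c * suc n * (F * x)
  regroup₂ = solve-∀

level-pair-bound : ∀ m k j → j < k → (m + j) + suc (m + j) ≤ 2 * m + 2 * k
level-pair-bound m k j j<k = begin
  (m + j) + suc (m + j) ≡⟨ regroup m j ⟩
  2 * m + suc (2 * j)   ≤⟨ +-monoʳ-≤ (2 * m) (≤-trans (n≤1+n _) (≤-reflexive (sym (*-suc 2 j)))) ⟩
  2 * m + 2 * suc j     ≤⟨ +-monoʳ-≤ (2 * m) (*-monoʳ-≤ 2 j<k) ⟩
  2 * m + 2 * k ∎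
  where
  open ≤-Reasoning
  regroup : ∀ m j → (m + j) + suc (m + j) ≡ 2 * m + suc (2 * j)
  regroup = solve-∀

up≤down+2k : ∀ D m k j → j < k → 2 * m ≤ D → up m j ≤ down D m j + 2 * k
up≤down+2k D m k j j<k 2m≤D = +-cancelˡ-≤ (m + j) _ _ (begin
  (m + j) + up m j                        ≤⟨ level-pair-bound m k j j<k ⟩
  2 * m + 2 * k                           ≤⟨ +-monoˡ-≤ (2 * k) 2m≤D ⟩
  D + 2 * k                               ≤⟨ +-monoˡ-≤ (2 * k) (m≤n+m∸n D (m + j)) ⟩
  (m + j) + down D m j + 2 * k            ≡⟨ +-assoc (m + j) _ _ ⟩
  (m + j) + (down D m j + 2 * k) ∎)
  where open ≤-Reasoning

up≤down : ∀ D m k j → j < k → suc (suc m) ≤ 4 * (k * k) → 10 * (k * k) < D → up m j ≤ down D m j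
up≤down D m k j j<k small big = m+n≤o⇒m≤o∸n (up m j) (<⇒≤ (begin-strict
  up m j + (m + j)          ≡⟨ +-comm (up m j) (m + j) ⟩
  (m + j) + up m j          ≤⟨ level-pair-bound m k j j<k ⟩
  2 * m + 2 * k             ≤⟨ m≤m+n (2 * m + 2 * k) 4 ⟩
  2 * m + 2 * k + 4         ≡⟨ regroup m k ⟩
  2 * suc (suc m) + 2 * k   ≤⟨ +-mono-≤ (*-monoʳ-≤ 2 small) (*-monoʳ-≤ 2 (m≤m*n k k)) ⟩
  2 * (4 * (k * k)) + 2 * (k * k) ≡⟨ ten k ⟩
  10 * (k * k)              <⟨ big ⟩
  D ∎))
  where
  open ≤-Reasoning
  instance
    k≢0 : NonZero k
    k≢0 = >-nonZero (≤-<-trans z≤n j<k)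
  regroup : ∀ m k → 2 * m + 2 * k + 4 ≡ 2 * suc (suc m) + 2 * k
  regroup = solve-∀
  ten : ∀ k → 2 * (4 * (k * k)) + 2 * (k * k) ≡ 10 * (k * k)
  ten = solve-∀

≤-⊓-+ : ∀ x y c → x ≤ y + c → x ≤ y ⊓ x + c
≤-⊓-+ x y c x≤y+c = subst (x ≤_) (sym (+-distribʳ-⊓ c y x)) (⊓-glb x≤y+c (m≤m+n x c))

-- Far below the middle every factor up ≤ down; otherwise
-- m + 1 ≥ 4k² and the perturbation bound applies with c = 2k.
up-down-ratio : ∀ D m k → 2 * m ≤ D → 10 * (k * k) < D → prod k (up m) ≤ 2 * prod k (down D m)
up-down-ratio D m k 2m≤D big with 4 * (k * k) ≤? suc m
... | no small = ≤-trans (prod-mono k (λ j j<k → up≤down D m k j j<k (≰⇒> small) big))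
                         (m≤m+n (prod k (down D m)) _)
... | yes large = ≤-trans (*-cancelˡ-≤ M halved) (*-monoʳ-≤ 2 (prod-mono k (λ j _ → m⊓n≤m _ _)))
  where
  M = suc m
  capped : ℕ → ℕ
  capped j = down D m j ⊓ up m j
  X = prod k (up m)
  G = prod k capped
  perturbed : M * X ≤ M * G + 2 * k * k * X
  perturbed = prod-perturb M (2 * k) k λ j j<k →
    m⊓n≤n _ _ , ≤-⊓-+ (up m j) (down D m j) (2 * k) (up≤down+2k D m k j j<k 2m≤D) , s≤s (m≤m+n m j)
  regroup : ∀ M G k X → (M * G + 2 * k * k * X) + (M * G + 2 * k * k * X) ≡ M * (2 * G) + 4 * (k * k) * X
  regroup = solve-∀
  halved : M * X ≤ M * (2 * G)
  halved = +-cancelʳ-≤ (M * X) _ _ (begin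
    M * X + M * X                                     ≤⟨ +-mono-≤ perturbed perturbed ⟩
    (M * G + 2 * k * k * X) + (M * G + 2 * k * k * X) ≡⟨ regroup M G k X ⟩
    M * (2 * G) + 4 * (k * k) * X                     ≤⟨ +-monoʳ-≤ (M * (2 * G)) (*-monoˡ-≤ X large) ⟩
    M * (2 * G) + M * X ∎)
    where open ≤-Reasoning

prod-up-nonZero : ∀ m n → NonZero (prod n (up m))
prod-up-nonZero m zero = _
prod-up-nonZero m (suc n) = m*n≢0 (prod n (up m)) (up m n) {{prod-up-nonZero m n}}

shadow^-halves : ∀ {D} c m k (B : List (F₂^ D)) → Unique B → AtLevel c m B →
  2 * m ≤ D → 10 * (k * k) < D → length B ≤ 2 * length (shadow^ c k B)
shadow^-halves {D} c m k B uB lvl 2m≤D big =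
  *-cancelʳ-≤ (length B) (2 * length Bₖ) X {{prod-up-nonZero m k}} (begin
    length B * X              ≤⟨ *-monoʳ-≤ (length B) (up-down-ratio D m k 2m≤D big) ⟩
    length B * (2 * Y)        ≡⟨ regroup (length B) Y ⟩
    2 * (length B * Y)        ≤⟨ *-monoʳ-≤ 2 (shadow^-LYM c m k B uB lvl) ⟩
    2 * (length Bₖ * X)       ≡⟨ *-assoc 2 (length Bₖ) X ⟨
    2 * length Bₖ * X ∎)
  where
  open ≤-Reasoning
  Bₖ = shadow^ c k B
  X = prod k (up m)
  Y = prod k (down D m)
  regroup : ∀ b y → b * (2 * y) ≡ 2 * (b * y)
  regroup = solve-∀

module _ {a} {X : Set a} (κ : X → ℕ) where

  layer : ℕ → List X → List X
  layer w = filter (λ x → κ x ≟ w)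

  ∈-layer⁻ : ∀ w xs {x} → x ∈ layer w xs → x ∈ xs × κ x ≡ w
  ∈-layer⁻ w xs = ∈-filter⁻ (λ x → κ x ≟ w)

  layer-unique : ∀ w xs → Unique xs → Unique (layer w xs)
  layer-unique w xs = Unique.filter⁺ (λ x → κ x ≟ w)

  below : ℕ → List X → List X
  below n = filter (λ x → κ x <? n)

  length-below-suc : ∀ n xs → length (below (suc n) xs) ≡ length (below n xs) + length (layer n xs)
  length-below-suc n [] = refl
  length-below-suc n (x ∷ xs) with <-cmp (κ x) n
  ... | tri< κx<n κx≢n _
    rewrite filter-accept (λ x → κ x <? suc n) {x} {xs} (m<n⇒m<1+n κx<n)
          | filter-accept (λ x → κ x <? n) {x} {xs} κx<n
          | filter-reject (λ x → κ x ≟ n) {x} {xs} κx≢n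
          = cong suc (length-below-suc n xs)
  ... | tri≈ κx≮n κx≡n _
    rewrite filter-accept (λ x → κ x <? suc n) {x} {xs} (s≤s (≤-reflexive κx≡n))
          | filter-reject (λ x → κ x <? n) {x} {xs} κx≮n
          | filter-accept (λ x → κ x ≟ n) {x} {xs} κx≡n
          = trans (cong suc (length-below-suc n xs)) (sym (+-suc _ _))
  ... | tri> _ κx≢n n<κx
    rewrite filter-reject (λ x → κ x <? suc n) {x} {xs} (λ κx<1+n → <⇒≱ n<κx (≤-pred κx<1+n))
          | filter-reject (λ x → κ x <? n) {x} {xs} (<⇒≯ n<κx)
          | filter-reject (λ x → κ x ≟ n) {x} {xs} κx≢n
          = length-below-suc n xs

module LayerCount {a b} {X : Set a} {Y : Set b} (κ : X → ℕ) (T : ℕ → List Y)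
  (T-unique : ∀ w → Unique (T w))
  (T-disjoint : ∀ {w w′ y} → y ∈ T w → y ∈ T w′ → w ≡ w′) where

  targets-below : ℕ → List Y
  targets-below zero = []
  targets-below (suc n) = T n ++ targets-below n

  ∈-targets-below⁻ : ∀ n {y} → y ∈ targets-below n → ∃ λ w → w < n × y ∈ T w
  ∈-targets-below⁻ (suc n) y∈ with ∈-++⁻ (T n) y∈
  ... | inj₁ y∈Tn = n , ≤-refl , y∈Tn
  ... | inj₂ y∈rest with ∈-targets-below⁻ n y∈rest
  ...   | w , w<n , y∈Tw = w , m<n⇒m<1+n w<n , y∈Tw

  targets-below-unique : ∀ n → Unique (targets-below n)
  targets-below-unique zero = []
  targets-below-unique (suc n) = Unique.++⁺ (T-unique n) (targets-below-unique n) disjoint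
    where
    disjoint : ∀ {y} → y ∈ T n × y ∈ targets-below n → ⊥
    disjoint (y∈Tn , y∈rest) with ∈-targets-below⁻ n y∈rest
    ... | w , w<n , y∈Tw = <-irrefl (T-disjoint y∈Tw y∈Tn) w<n

  below-count : ∀ r (xs : List X) → (∀ w → length (layer κ w xs) ≤ r * length (T w)) →
    ∀ n → length (below κ n xs) ≤ r * length (targets-below n)
  below-count r xs layer-bound zero =
    ≤-trans (≤-reflexive (cong length (filter-none (λ x → κ x <? 0) (All.tabulate {xs = xs} (λ _ ()))))) z≤n
  below-count r xs layer-bound (suc n) = begin
    length (below κ (suc n) xs)                      ≡⟨ length-below-suc κ n xs ⟩
    length (below κ n xs) + length (layer κ n xs)    ≤⟨ +-mono-≤ (below-count r xs layer-bound n)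
                                                                  (layer-bound n) ⟩
    r * length (targets-below n) + r * length (T n)  ≡⟨ *-distribˡ-+ r _ _ ⟨
    r * (length (targets-below n) + length (T n))    ≡⟨ cong (r *_) (+-comm (length (targets-below n)) _) ⟩
    r * (length (T n) + length (targets-below n))    ≡⟨ cong (r *_) (length-++ (T n)) ⟨
    r * length (targets-below (suc n)) ∎
    where open ≤-Reasoning

  layered-count : ∀ r N (xs : List X) (G : List Y) → All (λ x → κ x < N) xs →
    (∀ w → length (layer κ w xs) ≤ r * length (T w)) → (∀ {w y} → y ∈ T w → y ∈ G) →
    length xs ≤ r * length G
  layered-count r N xs G κ<N layer-bound T⊆G = begin
    length xs                  ≡⟨ cong length (filter-all (λ x → κ x <? N) κ<N) ⟨
    length (below κ N xs)      ≤⟨ below-count r xs layer-bound N ⟩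
    r * length (targets-below N) ≤⟨ *-monoʳ-≤ r (unique-⊆-length (targets-below-unique N) into-G) ⟩
    r * length G ∎
    where
    open ≤-Reasoning
    into-G : ∀ {y} → y ∈ targets-below N → y ∈ G
    into-G y∈ with ∈-targets-below⁻ N y∈
    ... | _ , _ , y∈Tw = T⊆G y∈Tw

inBand-bounds : ∀ {D} ℓ k (x : F₂^ D) → T (inBand ℓ k x) →
  (ℓ ℤ.≤ + wt x) × (+ suc (wt x) ℤ.≤ ℓ ℤ.+ + k)
inBand-bounds ℓ k x x∈Σ with Equivalence.to T-∧ x∈Σ
... | lower , upper = ℤ.≤ᵇ⇒≤ lower , ℤ.≤ᵇ⇒≤ upper

band-width : ∀ {D} ℓ k (x y : F₂^ D) → T (inBand ℓ k x) → T (inBand ℓ k y) → wt y < wt x + k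
band-width ℓ k x y x∈Σ y∈Σ = ℤ.drop‿+≤+ (ℤ.≤-trans y-upper (ℤ.+-monoˡ-≤ (+ k) x-lower))
  where
  x-lower = proj₁ (inBand-bounds ℓ k x x∈Σ)
  y-upper = proj₂ (inBand-bounds ℓ k y y∈Σ)

¬T⇒T-not : ∀ b → ¬ T b → T (not b)
¬T⇒T-not true ¬b = ¬b _
¬T⇒T-not false _ = _

∈-tuples : ∀ D k (s : Vec (Fin D) k) → s ∈ tuples D k
∈-tuples D zero [] = here refl
∈-tuples D (suc k) (i ∷ s) = ∈-concatMap⁺ (λ i → map (i ∷_) (tuples D k))
  (lose (∈-allFin i) (∈-map⁺ (i ∷_) (∈-tuples D k s)))

∈-sumset : ∀ {D k} {A : List (F₂^ D)} {a} → a ∈ A → (s : Vec (Fin D) k) →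
  a ⊕ sumBasis s ∈ sumset A (kS D k)
∈-sumset {D} {k} {a = a} a∈ s =
  ∈-concatMap⁺ (λ a → map (a ⊕_) (kS D k)) (lose a∈ (∈-map⁺ (a ⊕_) (∈-map⁺ sumBasis (∈-tuples D k s))))

complement-below-middle : ∀ D w → ¬ (2 * w ≤ D) → 2 * (D ∸ w) ≤ D
complement-below-middle D w 2w≰D = begin
  2 * (D ∸ w)     ≡⟨ *-distribˡ-∸ 2 D w ⟩
  2 * D ∸ 2 * w   ≤⟨ m≤n+o⇒m∸n≤o (2 * D) (2 * w) (begin
                       2 * D         ≡⟨ cong (λ n → D + n) (+-identityʳ D) ⟩
                       D + D         ≤⟨ +-monoˡ-≤ D (<⇒≤ (≰⇒> 2w≰D)) ⟩
                       2 * w + D ∎) ⟩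
  D ∎
  where open ≤-Reasoning

module _ {D : ℕ} (k : ℕ) where

  -- A layer is pushed up (toggling 0s) below the middle level and down
  -- (toggling 1s) above it, so that it always starts at a level ≤ D/2.
  direction : ℕ → Bool
  direction w with 2 * w ≤? D
  ... | yes _ = false
  ... | no _ = true

  target : List (F₂^ D) → ℕ → List (F₂^ D)
  target B w = shadow^ (direction w) k (layer (wt {D}) w B)

  target-unique : ∀ B → Unique B → ∀ w → Unique (target B w)
  target-unique B uB w = shadow^-unique (direction w) k _ (layer-unique (wt {D}) w B uB)

  target-origin : ∀ B w {y} → y ∈ target B w →
    ∃ λ a → a ∈ B × wt a ≡ w × ∃ λ (s : Vec (Fin D) k) → y ≡ a ⊕ sumBasis s
  target-origin B w y∈ with shadow^-origin (direction w) k (layer (wt {D}) w B) y∈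
  ... | a , a∈layer , s , y≡ with ∈-layer⁻ (wt {D}) w B a∈layer
  ... | a∈ , wa≡w = a , a∈ , wa≡w , s , y≡

  layer-level : ∀ B w → AtLevel false w (layer (wt {D}) w B)
  layer-level B w = All.tabulate λ a∈ → proj₂ (∈-layer⁻ (wt {D}) w B a∈)

  layer-colevel : ∀ B w → AtLevel true (D ∸ w) (layer (wt {D}) w B)
  layer-colevel B w = All.tabulate λ {a} a∈ →
    trans (cnt-by-complement false a) (cong (D ∸_) (proj₂ (∈-layer⁻ (wt {D}) w B a∈)))

  target-expands : ∀ B → Unique B → 10 * (k * k) < D → ∀ w →
    length (layer (wt {D}) w B) ≤ 2 * length (target B w)
  target-expands B uB big w with 2 * w ≤? D
  ... | yes 2w≤D =
    shadow^-halves false w k _ (layer-unique (wt {D}) w B uB) (layer-level B w) 2w≤D big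
  ... | no 2w≰D =
    shadow^-halves true (D ∸ w) k _ (layer-unique (wt {D}) w B uB) (layer-colevel B w)
      (complement-below-middle D w 2w≰D) big

  target-weight : ∀ B w {y} → y ∈ target B w → wt y ≡ w + k ⊎ wt y + k ≡ w
  target-weight B w {y} y∈ with target-origin B w y∈
  ... | a , _ , wa≡w , _ with 2 * w ≤? D
  ... | yes _ = inj₁ (All.lookup (shadow^-level false w k _ (layer-level B w)) y∈)
  ... | no _ = inj₂ (+-cancelʳ-≡ (D ∸ w) (wt y + k) w (begin
    wt y + k + (D ∸ w)         ≡⟨ +-assoc (wt y) k (D ∸ w) ⟩
    wt y + (k + (D ∸ w))       ≡⟨ cong (λ n → wt y + n) (trans (+-comm k (D ∸ w)) (sym cofalse)) ⟩
    cnt true y + cnt false y   ≡⟨ cnt-complement true y ⟩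
    D                          ≡⟨ m+[n∸m]≡n w≤D ⟨
    w + (D ∸ w) ∎))
    where
    open ≡-Reasoning
    cofalse : cnt false y ≡ D ∸ w + k
    cofalse = All.lookup (shadow^-level true (D ∸ w) k _ (layer-colevel B w)) y∈
    w≤D : w ≤ D
    w≤D = subst (_≤ D) wa≡w (count≤n (_≟B true) a)

  -- Inside the band no target point can be k levels above one layer and k
  -- levels below another: the layers would be 2k apart, but weights in Σ
  -- differ by less than k.
  no-crossing : ∀ {u w w′} → u ≡ w + k → u + k ≡ w′ → ¬ (w′ < w + k)
  no-crossing {w = w} refl refl w+2k<w+k = <-irrefl refl (≤-trans (s≤s (m≤m+n (w + k) k)) w+2k<w+k)

  target-disjoint : ∀ ℓ B → All (λ a → T (inBand ℓ k a)) B →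
    ∀ {w w′ y} → y ∈ target B w → y ∈ target B w′ → w ≡ w′
  target-disjoint ℓ B B⊆Σ {w} {w′} y∈ y∈′
    with target-origin B w y∈ | target-origin B w′ y∈′ | target-weight B w y∈ | target-weight B w′ y∈′
  ... | _ | _ | inj₁ up | inj₁ up′ = +-cancelʳ-≡ k w w′ (trans (sym up) up′)
  ... | _ | _ | inj₂ down | inj₂ down′ = trans (sym down) down′
  ... | a , a∈ , refl , _ | a′ , a′∈ , refl , _ | inj₁ up | inj₂ down′ =
    ⊥-elim (no-crossing up down′ (band-width ℓ k a a′ (All.lookup B⊆Σ a∈) (All.lookup B⊆Σ a′∈)))
  ... | a , a∈ , refl , _ | a′ , a′∈ , refl , _ | inj₂ down | inj₁ up′ =
    ⊥-elim (no-crossing up′ down (band-width ℓ k a′ a (All.lookup B⊆Σ a′∈) (All.lookup B⊆Σ a∈)))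

  target-outside : ∀ ℓ B → All (λ a → T (inBand ℓ k a)) B →
    ∀ w {y} → y ∈ target B w → ¬ T (inBand ℓ k y)
  target-outside ℓ B B⊆Σ w {y} y∈ y∈Σ with target-origin B w y∈ | target-weight B w y∈
  ... | a , a∈ , refl , _ | inj₁ up = <-irrefl up (band-width ℓ k a y (All.lookup B⊆Σ a∈) y∈Σ)
  ... | a , a∈ , refl , _ | inj₂ down =
    <-irrefl (sym down) (band-width ℓ k y a y∈Σ (All.lookup B⊆Σ a∈))

  target⊆outside : ∀ ℓ A → All (λ a → T (inBand ℓ k a)) A →
    ∀ w {y} → y ∈ target A w → y ∈ filterᵇ (λ x → not (inBand ℓ k x)) (sumset A (kS D k))
  target⊆outside ℓ A A⊆Σ w y∈ with target-origin A w y∈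
  ... | a , a∈ , _ , s , refl =
    ∈-filter⁺ (λ x → T? (not (inBand ℓ k x))) (∈-sumset a∈ s) (¬T⇒T-not _ (target-outside ℓ A A⊆Σ w y∈))

lemma2p1 : (D k : ℕ) → .{{NonZero D}} → .{{NonZero k}} → 10 * (k * k) < D →
    (ℓ : ℤ) → (A : List (F₂^ D)) → Unique A → All (λ a → T (inBand ℓ k a)) A →
    length A ≤ 2 * outside D k ℓ A
lemma2p1 D k big ℓ A uA A⊆Σ =
  LayerCount.layered-count wt (target k A) (target-unique k A uA) (target-disjoint k ℓ A A⊆Σ)
    2 (suc D) A _ weights<1+D (target-expands k A uA big)
    (λ {w} y∈ → ∈-deduplicate⁺ _≟V_ (target⊆outside k ℓ A A⊆Σ w y∈))
  where
  weights<1+D : All (λ a → wt a < suc D) A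
  weights<1+D = All.tabulate λ {a} _ → s≤s (count≤n (_≟B true) a)
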